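{- Each of the following colorings on $\mathbb{N}$ is reconstructible, for every finite $a\subseteq[\mathbb{N}]^2$: (i) $\varphi_a$, where $\varphi$ is a constant coloring on $\mathbb{N}$; (ii) $\varphi_a$, where $\varphi$ is a random graph coloring, i.e. for any two disjoint finite $A,B\subseteq\mathbb{N}$ there is $n\in\mathbb{N}$ with $\varphi(\{x,n\})=1$ for all $x\in A$ and $\varphi(\{y,n\})=0$ for all $y\in B$; (iii) $\varphi_a$, where $\varphi=\varphi_e$ is the Sierpiński coloring associated to an enumeration $e=(r_n)_n$ of $\mathbb{Q}$, i.e. $\varphi_e(\{n,m\})=1$ for $n<m$ iff $r_n<r_m$; (iv) $\varphi_a$, where $\varphi=\varphi_R$ for a linear ordering $R\subseteq\mathbb{N}\times\mathbb{N}$ of $\mathbb{N}$ with no maximal and no minimal element, defined by $\varphi_R(\{n,m\})=1$ for $n<m$ iff $(n,m)\in R$.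
   Context: A coloring on $\mathbb{N}$ is a function $\varphi:[\mathbb{N}]^2\to\{0,1\}$. For finite $a\subseteq[\mathbb{N}]^2$, the finite change $\varphi_a$ is defined by $\varphi_a(e)=\varphi(e)$ for $e\notin a$ and $\varphi_a(e)=1-\varphi(e)$ for $e\in a$. $\mathrm{hom}(\varphi)=\{H\subseteq\mathbb{N}:\ |H|>2 \text{ and } \varphi \text{ is constant on } [H]^2\}$. $\varphi$ is reconstructible if for every coloring $\psi$ on $\mathbb{N}$ with $\mathrm{hom}(\psi)=\mathrm{hom}(\varphi)$ one has $\psi=\varphi$ or $\psi=1-\varphi$. -}

module Defs where

open import Level using (0ℓ)
open import Data.Bool using (Bool; true; false; not; _xor_; if_then_else_)
open import Data.Nat using (ℕ; _<_; _⊓_; _⊔_)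
open import Data.Product using (Σ; ∃; ∃-syntax; _×_; _,_)
open import Data.Sum using (_⊎_)
open import Data.List using (List)
open import Data.List.Membership.Propositional using (_∈_; _∉_)
open import Data.List.Relation.Unary.Any using (any?)
open import Data.Rational as ℚ using (ℚ)
open import Relation.Nullary using (¬_; does)
open import Relation.Binary using (Rel)
open import Relation.Binary.Structures using (IsStrictTotalOrder)
open import Relation.Binary.PropositionalEquality using (_≡_; _≢_)
open import Relation.Unary using (Pred)
open import Function.Bundles using (_⇔_)
import Data.Nat.Properties as ℕP
open import Data.Product.Properties using (≡-dec)

-- A coloring on ℕ is represented by a function c : ℕ → ℕ → Bool; the color
-- of the unordered pair {x,y} (x ≢ y) is  col c x y = c (min x y) (max x y).
-- Values c x y with x ≥ y are irrelevant.
Coloring : Set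
Coloring = ℕ → ℕ → Bool

col : Coloring → ℕ → ℕ → Bool
col c x y = c (x ⊓ y) (x ⊔ y)

SameColoring : Coloring → Coloring → Set
SameColoring φ ψ = ∀ x y → x ≢ y → col φ x y ≡ col ψ x y

compl : Coloring → Coloring
compl φ x y = not (φ x y)

-- A finite set a ⊆ [ℕ]² is given by a list of pairs (x , y), each listed
-- pair standing for the unordered pair {x,y}.
FinEdgeSet : Set
FinEdgeSet = List (ℕ × ℕ)

inEdges : FinEdgeSet → ℕ → ℕ → Bool
inEdges a x y =
  does (any? (≡-dec ℕP._≟_ ℕP._≟_ (x , y)) a) Data.Bool.∨
  does (any? (≡-dec ℕP._≟_ ℕP._≟_ (y , x)) a)

change : Coloring → FinEdgeSet → Coloring
change φ a x y = inEdges a x y xor φ x y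

Subset : Set₁
Subset = Pred ℕ 0ℓ

AtLeastThree : Subset → Set
AtLeastThree H = ∃[ x ] ∃[ y ] ∃[ z ]
  (H x × H y × H z × x ≢ y × x ≢ z × y ≢ z)

ConstantOn : Coloring → Subset → Set
ConstantOn φ H = ∃[ b ] (∀ x y → H x → H y → x ≢ y → col φ x y ≡ b)

IsHom : Coloring → Subset → Set
IsHom φ H = AtLeastThree H × ConstantOn φ H

Reconstructible : Coloring → Set₁
Reconstructible φ =
  (ψ : Coloring) → ((H : Subset) → IsHom ψ H ⇔ IsHom φ H) →
  SameColoring ψ φ ⊎ SameColoring ψ (compl φ)

IsConstantColoring : Coloring → Set
IsConstantColoring φ = ∃[ b ] (∀ x y → x ≢ y → col φ x y ≡ b)

IsRandomGraphColoring : Coloring → Set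
IsRandomGraphColoring φ =
  (A B : List ℕ) → (∀ x → x ∈ A → x ∉ B) →
  ∃[ n ] (n ∉ A × n ∉ B ×
          (∀ x → x ∈ A → col φ x n ≡ true) ×
          (∀ y → y ∈ B → col φ y n ≡ false))

IsEnumerationOfℚ : (ℕ → ℚ) → Set
IsEnumerationOfℚ r = (∀ m n → r m ≡ r n → m ≡ n) × (∀ q → ∃[ n ] r n ≡ q)

sierpinski : (ℕ → ℚ) → Coloring
sierpinski r n m = does (r n ℚ.<? r m)

IsLinearOrderNoEndpoints : Rel ℕ 0ℓ → Set
IsLinearOrderNoEndpoints R =
  IsStrictTotalOrder _≡_ R × (∀ n → ∃[ m ] R n m) × (∀ n → ∃[ m ] R m n)

IsColoringOfOrder : Rel ℕ 0ℓ → Coloring → Set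
IsColoringOfOrder R φ = ∀ n m → n < m → (φ n m ≡ true ⇔ R n m)

-- Every colouring χ considered here has an extension property: for some colour c,
-- every finite set A of vertices has a vertex w outside A with all pairs {x,w}
-- (x ∈ A) coloured c; for a finite change φ_a one simply picks w outside the
-- finitely many vertices of a. Suppose hom(ψ) = hom(χ). Then ψ and χ have the
-- same monochromatic triangles. Let D mark the pairs on which ψ and χ disagree.
-- On a χ-monochromatic triangle D is constant; on a triangle with exactly two
-- χ-equal edges on which D agrees, D also agrees on the third edge, since
-- otherwise ψ would be monochromatic there while χ is not. Passing through
-- common c-neighbours, these two facts show that D is the same on all pairs at
-- a vertex, hence constant: ψ = χ or ψ = 1 - χ.
module Submission where

open import Defs
open import Level using (0ℓ)
open import Data.Bool using (Bool; true; false; not; _xor_)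
import Data.Bool as Bool
open import Data.Bool.Properties using (∨-comm; not-involutive; xor-assoc; xor-same; xor-identityʳ; ¬-not)
open import Data.Nat using (ℕ; zero; suc; _<_; s≤s)
import Data.Nat.Properties as ℕ
open import Data.Nat.GeneralisedArithmetic using (fold)
open import Data.List using (List; []; _∷_; _++_; filter)
open import Data.List.Extrema.Nat using (max; xs≤max)
open import Data.List.Relation.Unary.Any using (here; there; any?)
import Data.List.Relation.Unary.All as All
open import Data.List.Membership.Propositional using (_∈_; _∉_)
open import Data.List.Membership.Propositional.Properties using (∈-++⁺ˡ; ∈-++⁺ʳ; ∈-filter⁺; ∈-filter⁻)
open import Data.List.Membership.DecPropositional ℕ._≟_ using (_∉?_)
open import Data.Fin using (Fin; toℕ; fromℕ<)
import Data.Fin.Properties as Fin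
open import Data.Product using (∃; ∃-syntax; _×_; _,_; proj₁; proj₂)
open import Data.Product.Properties using (≡-dec)
open import Data.Rational as ℚ using (ℚ)
import Data.Rational.Properties as ℚₚ
open import Data.Sum using (_⊎_; inj₁; inj₂)
open import Function using (_∘_)
open import Function.Bundles using (_⇔_; mk⇔; Equivalence)
open import Function.Definitions using (Injective)
import Function.Properties.Equivalence as ⇔
open import Relation.Nullary using (Dec; yes; no; does; contradiction)
open import Relation.Nullary.Decidable using (dec-false)
open import Relation.Binary using (Rel; Trichotomous; tri<; tri≈; tri>)
open import Relation.Binary.Structures using (IsStrictTotalOrder)
open import Relation.Binary.PropositionalEquality

col-sym : ∀ χ x y → col χ x y ≡ col χ y x
col-sym χ x y rewrite ℕ.⊓-comm x y | ℕ.⊔-comm x y = refl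

Triangle : ℕ → ℕ → ℕ → Subset
Triangle x y z n = n ≡ x ⊎ n ≡ y ⊎ n ≡ z

Monochromatic : Coloring → ℕ → ℕ → ℕ → Set
Monochromatic χ x y z = col χ x y ≡ col χ x z × col χ x y ≡ col χ y z

isHom-triangle⇔monochromatic : ∀ {χ x y z} → x ≢ y → x ≢ z → y ≢ z →
  IsHom χ (Triangle x y z) ⇔ Monochromatic χ x y z
isHom-triangle⇔monochromatic {χ} {x} {y} {z} x≢y x≢z y≢z = mk⇔ to from
  where
  to : IsHom χ (Triangle x y z) → Monochromatic χ x y z
  to (_ , b , const) =
    trans xy≡b (sym (const x z (inj₁ refl) (inj₂ (inj₂ refl)) x≢z)) ,
    trans xy≡b (sym (const y z (inj₂ (inj₁ refl)) (inj₂ (inj₂ refl)) y≢z))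
    where
    xy≡b : col χ x y ≡ b
    xy≡b = const x y (inj₁ refl) (inj₂ (inj₁ refl)) x≢y

  from : Monochromatic χ x y z → IsHom χ (Triangle x y z)
  from (xy≡xz , xy≡yz) =
    (x , y , z , inj₁ refl , inj₂ (inj₁ refl) , inj₂ (inj₂ refl) , x≢y , x≢z , y≢z) ,
    col χ x y , const
    where
    const : ∀ u v → Triangle x y z u → Triangle x y z v → u ≢ v → col χ u v ≡ col χ x y
    const u v (inj₁ refl)        (inj₁ refl)        u≢v = contradiction refl u≢v
    const u v (inj₁ refl)        (inj₂ (inj₁ refl)) _   = refl
    const u v (inj₁ refl)        (inj₂ (inj₂ refl)) _   = sym xy≡xz
    const u v (inj₂ (inj₁ refl)) (inj₁ refl)        _   = col-sym χ y x
    const u v (inj₂ (inj₁ refl)) (inj₂ (inj₁ refl)) u≢v = contradiction refl u≢v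
    const u v (inj₂ (inj₁ refl)) (inj₂ (inj₂ refl)) _   = sym xy≡yz
    const u v (inj₂ (inj₂ refl)) (inj₁ refl)        _   = trans (col-sym χ z x) (sym xy≡xz)
    const u v (inj₂ (inj₂ refl)) (inj₂ (inj₁ refl)) _   = trans (col-sym χ z y) (sym xy≡yz)
    const u v (inj₂ (inj₂ refl)) (inj₂ (inj₂ refl)) u≢v = contradiction refl u≢v

record Cone (χ : Coloring) (c : Bool) (A : List ℕ) (w : ℕ) : Set where
  field
    outside : w ∉ A
    joined  : ∀ {x} → x ∈ A → col χ x w ≡ c

  ≢apex : ∀ {x} → x ∈ A → x ≢ w
  ≢apex x∈A refl = outside x∈A

ExtensionProperty : Coloring → Bool → Set
ExtensionProperty χ c = (A : List ℕ) → ∃ (Cone χ c A)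

not-xor-not : ∀ a b → not a xor not b ≡ a xor b
not-xor-not false b = not-involutive b
not-xor-not true  b = refl

module Disagreement
  (χ ψ : Coloring)
  (sameTriangles : ∀ {x y z} → x ≢ y → x ≢ z → y ≢ z →
                   Monochromatic ψ x y z ⇔ Monochromatic χ x y z)
  (c : Bool) (ext : ExtensionProperty χ c)
  where

  D : ℕ → ℕ → Bool
  D x y = col ψ x y xor col χ x y

  D-sym : ∀ x y → D x y ≡ D y x
  D-sym x y = cong₂ _xor_ (col-sym ψ x y) (col-sym χ x y)

  ψ≡D-xor-χ : ∀ x y → col ψ x y ≡ D x y xor col χ x y
  ψ≡D-xor-χ x y = sym (begin
    (col ψ x y xor col χ x y) xor col χ x y ≡⟨ xor-assoc (col ψ x y) _ _ ⟩
    col ψ x y xor (col χ x y xor col χ x y) ≡⟨ cong (col ψ x y xor_) (xor-same (col χ x y)) ⟩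
    col ψ x y xor false                     ≡⟨ xor-identityʳ _ ⟩
    col ψ x y                               ∎)
    where open ≡-Reasoning

  monochromatic-c : ∀ {x y z} → col χ x y ≡ c → col χ x z ≡ c → col χ y z ≡ c →
                    Monochromatic χ x y z
  monochromatic-c xy xz yz = trans xy (sym xz) , trans xy (sym yz)

  D-monochromatic : ∀ {x y z} → x ≢ y → x ≢ z → y ≢ z →
                    Monochromatic χ x y z → D x y ≡ D x z
  D-monochromatic x≢y x≢z y≢z mono@(xy≡xz , _) =
    cong₂ _xor_ (proj₁ (Equivalence.from (sameTriangles x≢y x≢z y≢z) mono)) xy≡xz

  D-third : ∀ {x y z} → x ≢ y → x ≢ z → y ≢ z →
            col χ x y ≡ col χ x z → col χ y z ≢ col χ x y →
            D x y ≡ D x z → D y z ≡ D x y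
  D-third {x} {y} {z} x≢y x≢z y≢z χxy≡χxz χyz≢χxy Dxy≡Dxz with D y z Bool.≟ D x y
  ... | yes Dyz≡Dxy = Dyz≡Dxy
  ... | no  Dyz≢Dxy = contradiction (sym (proj₂ χ-mono)) χyz≢χxy
    where
    ψxy≡ψyz : col ψ x y ≡ col ψ y z
    ψxy≡ψyz = begin
      col ψ x y                           ≡⟨ ψ≡D-xor-χ x y ⟩
      D x y xor col χ x y                 ≡⟨ not-xor-not (D x y) (col χ x y) ⟨
      not (D x y) xor not (col χ x y)     ≡⟨ cong₂ _xor_ (¬-not Dyz≢Dxy) (¬-not χyz≢χxy) ⟨
      D y z xor col χ y z                 ≡⟨ ψ≡D-xor-χ y z ⟨
      col ψ y z                           ∎
      where open ≡-Reasoning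

    ψ-mono : Monochromatic ψ x y z
    ψ-mono = trans (ψ≡D-xor-χ x y) (trans (cong₂ _xor_ Dxy≡Dxz χxy≡χxz) (sym (ψ≡D-xor-χ x z))) ,
             ψxy≡ψyz

    χ-mono : Monochromatic χ x y z
    χ-mono = Equivalence.to (sameTriangles x≢y x≢z y≢z) ψ-mono

  common-neighbour : ∀ x y z → ∃[ w ] ((x ≢ w × y ≢ w × z ≢ w) ×
                                        (col χ x w ≡ c × col χ y w ≡ c × col χ z w ≡ c))
  common-neighbour x y z =
    w , (≢apex x∈ , ≢apex y∈ , ≢apex z∈) , (joined x∈ , joined y∈ , joined z∈)
    where
    w = proj₁ (ext (x ∷ y ∷ z ∷ []))
    open Cone (proj₂ (ext (x ∷ y ∷ z ∷ [])))
    x∈ : x ∈ x ∷ y ∷ z ∷ []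
    x∈ = here refl
    y∈ : y ∈ x ∷ y ∷ z ∷ []
    y∈ = there (here refl)
    z∈ : z ∈ x ∷ y ∷ z ∷ []
    z∈ = there (there (here refl))

  D-common-neighbour : ∀ {x y w} → x ≢ y → x ≢ w → y ≢ w →
                       col χ x w ≡ c → col χ y w ≡ c → D x y ≡ D x w
  D-common-neighbour {x} {y} {w} x≢y x≢w y≢w xw yw with col χ x y Bool.≟ c
  ... | yes xy = D-monochromatic x≢y x≢w y≢w (monochromatic-c xy xw yw)
  ... | no  xy≢c = trans (D-third w≢x w≢y x≢y (trans wx (sym wy)) (λ e → xy≢c (trans e wx)) Dwx≡Dwy)
                         (D-sym w x)
    where
    w≢x : w ≢ x
    w≢x = ≢-sym x≢w
    w≢y : w ≢ y
    w≢y = ≢-sym y≢w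
    wx : col χ w x ≡ c
    wx = trans (col-sym χ w x) xw
    wy : col χ w y ≡ c
    wy = trans (col-sym χ w y) yw
    Dwx≡Dwy : D w x ≡ D w y
    Dwx≡Dwy =
      let w′ , (x≢w′ , y≢w′ , w≢w′) , (xw′ , yw′ , ww′) = common-neighbour x y w
      in trans (D-monochromatic w≢x w≢w′ x≢w′ (monochromatic-c wx ww′ xw′))
               (sym (D-monochromatic w≢y w≢w′ y≢w′ (monochromatic-c wy ww′ yw′)))

  D-star : ∀ {x y z} → x ≢ y → x ≢ z → D x y ≡ D x z
  D-star {x} {y} {z} x≢y x≢z =
    let w , (x≢w , y≢w , z≢w) , (xw , yw , zw) = common-neighbour x y z
    in trans (D-common-neighbour x≢y x≢w y≢w xw yw) (sym (D-common-neighbour x≢z x≢w z≢w xw zw))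

  D-constant : ∀ {u v s t} → u ≢ v → s ≢ t → D u v ≡ D s t
  D-constant {u} {v} {s} {t} u≢v s≢t with u ℕ.≟ s
  ... | yes refl = D-star u≢v s≢t
  ... | no  u≢s  = trans (D-star u≢v u≢s) (trans (D-sym u s) (D-star (≢-sym u≢s) s≢t))

  ψ≡D01-xor-χ : ∀ x y → x ≢ y → col ψ x y ≡ D 0 1 xor col χ x y
  ψ≡D01-xor-χ x y x≢y = trans (ψ≡D-xor-χ x y) (cong (_xor col χ x y) (D-constant {s = 0} {t = 1} x≢y λ ()))

  agree-or-complement : SameColoring ψ χ ⊎ SameColoring ψ (compl χ)
  agree-or-complement with D 0 1 | ψ≡D01-xor-χ
  ... | false | ψ≡χ  = inj₁ ψ≡χ
  ... | true  | ψ≡¬χ = inj₂ ψ≡¬χ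

reconstructible-of-extension : ∀ {χ c} → ExtensionProperty χ c → Reconstructible χ
reconstructible-of-extension {χ} {c} ext ψ sameHom =
  Disagreement.agree-or-complement χ ψ sameTriangles c ext
  where
  sameTriangles : ∀ {x y z} → x ≢ y → x ≢ z → y ≢ z →
                  Monochromatic ψ x y z ⇔ Monochromatic χ x y z
  sameTriangles x≢y x≢z y≢z =
    ⇔.trans (⇔.sym (isHom-triangle⇔monochromatic {ψ} x≢y x≢z y≢z))
            (⇔.trans (sameHom _) (isHom-triangle⇔monochromatic {χ} x≢y x≢z y≢z))

verts : FinEdgeSet → List ℕ
verts []             = []
verts ((x , y) ∷ a) = x ∷ y ∷ verts a

∈-verts : ∀ {a x y} → (x , y) ∈ a → x ∈ verts a × y ∈ verts a
∈-verts {(u , v) ∷ a} (here refl) = here refl , there (here refl)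
∈-verts {(u , v) ∷ a} (there xy∈a) =
  let x∈ , y∈ = ∈-verts xy∈a in there (there x∈) , there (there y∈)

inEdges-sym : ∀ a x y → inEdges a x y ≡ inEdges a y x
inEdges-sym a x y =
  ∨-comm (does (any? (≡-dec ℕ._≟_ ℕ._≟_ (x , y)) a)) (does (any? (≡-dec ℕ._≟_ ℕ._≟_ (y , x)) a))

inEdges-outside : ∀ {a x y} → y ∉ verts a → inEdges a x y ≡ false
inEdges-outside {a} {x} {y} y∉
  rewrite dec-false (any? (≡-dec ℕ._≟_ ℕ._≟_ (x , y)) a) (y∉ ∘ proj₂ ∘ ∈-verts)
        | dec-false (any? (≡-dec ℕ._≟_ ℕ._≟_ (y , x)) a) (y∉ ∘ proj₁ ∘ ∈-verts) = refl

col-change : ∀ φ a x y → col (change φ a) x y ≡ inEdges a x y xor col φ x y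
col-change φ a x y with ℕ.≤-total x y
... | inj₁ x≤y rewrite ℕ.m≤n⇒m⊓n≡m x≤y | ℕ.m≤n⇒m⊔n≡n x≤y = refl
... | inj₂ y≤x rewrite ℕ.m≥n⇒m⊓n≡n y≤x | ℕ.m≥n⇒m⊔n≡m y≤x = cong (_xor φ y x) (inEdges-sym a y x)

col-change-outside : ∀ {φ a x w} → w ∉ verts a → col (change φ a) x w ≡ col φ x w
col-change-outside {φ} {a} {x} {w} w∉ =
  trans (col-change φ a x w) (cong (_xor col φ x w) (inEdges-outside w∉))

FreshExtensionProperty : Coloring → Bool → Set
FreshExtensionProperty φ c = (A F : List ℕ) → ∃[ w ] (w ∉ F × Cone φ c A w)

extension-change : ∀ {φ c} → FreshExtensionProperty φ c → ∀ a → ExtensionProperty (change φ a) c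
extension-change {φ} fresh a A with fresh A (verts a)
... | w , w∉ , cone = w , record
  { outside = Cone.outside cone
  ; joined  = λ x∈A → trans (col-change-outside {φ} w∉) (Cone.joined cone x∈A) }

beyond-max : ∀ {xs w x} → max 0 xs < w → x ∈ xs → x < w
beyond-max {xs} max<w x∈xs = ℕ.≤-<-trans (All.lookup (xs≤max 0 xs) x∈xs) max<w

beyond-max-∉ : ∀ {xs w} → max 0 xs < w → w ∉ xs
beyond-max-∉ max<w w∈xs = ℕ.<-irrefl refl (beyond-max max<w w∈xs)

cone-beyond-max : ∀ {φ c A F w} → max 0 (A ++ F) < w →
  (∀ {x} → x ∈ A → x < w → col φ x w ≡ c) → w ∉ F × Cone φ c A w
cone-beyond-max {A = A} max<w colour =
  beyond-max-∉ max<w ∘ ∈-++⁺ʳ A ,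
  record { outside = beyond-max-∉ max<w ∘ ∈-++⁺ˡ
         ; joined  = λ x∈A → colour x∈A (beyond-max max<w (∈-++⁺ˡ x∈A)) }

constant-freshExtension : ∀ {φ b} → (∀ x y → x ≢ y → col φ x y ≡ b) → FreshExtensionProperty φ b
constant-freshExtension const A F =
  suc (max 0 (A ++ F)) , cone-beyond-max ℕ.≤-refl (λ _ x<w → const _ _ (ℕ.<⇒≢ x<w))

randomGraph-freshExtension : ∀ {φ} → IsRandomGraphColoring φ → FreshExtensionProperty φ true
randomGraph-freshExtension random A F =
  let w , w∉A , w∉B , toA , _ = random A B disjoint
  in w , (λ w∈F → w∉B (∈-filter⁺ (_∉? A) w∈F w∉A)) , record { outside = w∉A ; joined = toA _ }
  where
  B : List ℕ
  B = filter (_∉? A) F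
  disjoint : ∀ x → x ∈ A → x ∉ B
  disjoint x x∈A x∈B = proj₂ (∈-filter⁻ (_∉? A) {xs = F} x∈B) x∈A

injective⇒unbounded : (f : ℕ → ℕ) → Injective _≡_ _≡_ f → ∀ N → ∃[ k ] N < f k
injective⇒unbounded f f-injective N with Fin.any? {n = suc (suc N)} (λ k → N ℕ.<? f (toℕ k))
... | yes (k , N<fk) = toℕ k , N<fk
... | no  all≤N =
  -- otherwise f 0, …, f (N + 1) all lie in [0, N], so two of them coincide
  let i , j , i<j , squeeze-i≡j = Fin.pigeonhole (ℕ.n<1+n (suc N)) squeeze
  in contradiction (f-injective (squeeze-reflects squeeze-i≡j)) (ℕ.<⇒≢ i<j)
  where
  squeeze : Fin (suc (suc N)) → Fin (suc N)
  squeeze k = fromℕ< (s≤s (ℕ.≮⇒≥ (λ N<fk → all≤N (k , N<fk))))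
  squeeze-reflects : ∀ {i j} → squeeze i ≡ squeeze j → f (toℕ i) ≡ f (toℕ j)
  squeeze-reflects {i} {j} eq = begin
    f (toℕ i)              ≡⟨ Fin.toℕ-fromℕ< _ ⟨
    toℕ (squeeze i)        ≡⟨ cong toℕ eq ⟩
    toℕ (squeeze j)        ≡⟨ Fin.toℕ-fromℕ< _ ⟩
    f (toℕ j)              ∎
    where open ≡-Reasoning

module StrictTotalOrderUnboundedAbove
  {R : Rel ℕ 0ℓ} (isSTO : IsStrictTotalOrder _≡_ R) (unbounded : ∀ n → ∃[ m ] R n m)
  where

  open IsStrictTotalOrder isSTO using (compare) renaming (trans to R-trans; irrefl to R-irrefl)

  next : ℕ → ℕ
  next n = proj₁ (unbounded n)

  R-next : ∀ n → R n (next n)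
  R-next n = proj₂ (unbounded n)

  strictUpperBound : (A : List ℕ) → ∃[ m ] (∀ {x} → x ∈ A → R x m)
  strictUpperBound []      = 0 , λ ()
  strictUpperBound (x ∷ A) with strictUpperBound A
  ... | m , A<m with compare x m
  ...   | tri< x<m _ _ = m , λ { (here refl) → x<m ; (there y∈A) → A<m y∈A }
  ...   | tri≈ _ refl _ = next x , λ { (here refl) → R-next x ; (there y∈A) → R-trans (A<m y∈A) (R-next x) }
  ...   | tri> _ _ m<x = next x , λ { (here refl) → R-next x
                                     ; (there y∈A) → R-trans (R-trans (A<m y∈A) m<x) (R-next x) }

  ascending : ℕ → ℕ → ℕ
  ascending m = fold (next m) next

  R-ascending : ∀ m k → R m (ascending m k)
  R-ascending m zero    = R-next m
  R-ascending m (suc k) = R-trans (R-ascending m k) (R-next (ascending m k))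

  ascending-strictMono : ∀ m {i j} → i < j → R (ascending m i) (ascending m j)
  ascending-strictMono m {i} {suc j} (s≤s i≤j) with i ℕ.≟ j
  ... | yes refl = R-next (ascending m i)
  ... | no  i≢j  = R-trans (ascending-strictMono m (ℕ.≤∧≢⇒< i≤j i≢j)) (R-next (ascending m j))

  ascending-injective : ∀ m → Injective _≡_ _≡_ (ascending m)
  ascending-injective m {i} {j} eq with ℕ.<-cmp i j
  ... | tri< i<j _ _ = contradiction (ascending-strictMono m i<j) (R-irrefl eq)
  ... | tri≈ _ i≡j _ = i≡j
  ... | tri> _ _ j<i = contradiction (ascending-strictMono m j<i) (R-irrefl (sym eq))

  successor-beyond : ∀ m N → ∃[ w ] (N < w × R m w)
  successor-beyond m N =
    let k , N<w = injective⇒unbounded (ascending m) (ascending-injective m) N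
    in ascending m k , N<w , R-ascending m k

  -- φ({x,w}) = 1 needs x < w as well as R x w, so the apex is chosen
  -- numerically beyond A and F, not merely R-above A.
  order-freshExtension : ∀ {φ} → IsColoringOfOrder R φ → FreshExtensionProperty φ true
  order-freshExtension {φ} φ-of-R A F =
    let m , A<m = strictUpperBound A
        w , max<w , m<w = successor-beyond m (max 0 (A ++ F))
    in w , cone-beyond-max max<w (λ x∈A x<w → colour x<w (R-trans (A<m x∈A) m<w))
    where
    colour : ∀ {x w} → x < w → R x w → col φ x w ≡ true
    colour {x} {w} x<w xRw rewrite ℕ.m≤n⇒m⊓n≡m (ℕ.<⇒≤ x<w) | ℕ.m≤n⇒m⊔n≡n (ℕ.<⇒≤ x<w) =
      Equivalence.from (φ-of-R x w x<w) xRw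

does≡true⇔ : ∀ {P : Set} (P? : Dec P) → does P? ≡ true ⇔ P
does≡true⇔ (yes p) = mk⇔ (λ _ → p) (λ _ → refl)
does≡true⇔ (no ¬p) = mk⇔ (λ ()) (λ p → contradiction p ¬p)

module _ (r : ℕ → ℚ) where

  _≺_ : Rel ℕ 0ℓ
  n ≺ m = r n ℚ.< r m

  sierpinski-isStrictTotalOrder : Injective _≡_ _≡_ r → IsStrictTotalOrder _≡_ _≺_
  sierpinski-isStrictTotalOrder r-injective = record
    { isStrictPartialOrder = record
      { isEquivalence = isEquivalence
      ; irrefl        = λ { refl → ℚₚ.<-irrefl refl }
      ; trans         = ℚₚ.<-trans
      ; <-resp-≈      = (λ { refl lt → lt }) , (λ { refl lt → lt })
      }
    ; compare = compare
    }
    where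
    compare : Trichotomous _≡_ _≺_
    compare n m with ℚₚ.<-cmp (r n) (r m)
    ... | tri< a ¬b ¬c = tri< a (¬b ∘ cong r) ¬c
    ... | tri≈ ¬a b ¬c = tri≈ ¬a (r-injective b) ¬c
    ... | tri> ¬a ¬b c = tri> ¬a (¬b ∘ cong r) c

  sierpinski-unboundedAbove : (∀ q → ∃[ n ] r n ≡ q) → ∀ n → ∃[ m ] n ≺ m
  sierpinski-unboundedAbove r-surjective n =
    let m , rm≡ = r-surjective (r n ℚ.+ ℚ.1ℚ)
    in m , subst (r n ℚ.<_) (sym rm≡) rn<rn+1
    where
    rn<rn+1 : r n ℚ.< r n ℚ.+ ℚ.1ℚ
    rn<rn+1 = subst (ℚ._< r n ℚ.+ ℚ.1ℚ) (ℚₚ.+-identityʳ (r n)) (ℚₚ.+-monoʳ-< (r n) (ℚₚ.positive⁻¹ ℚ.1ℚ))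

  sierpinski-isColoringOfOrder : IsColoringOfOrder _≺_ (sierpinski r)
  sierpinski-isColoringOfOrder n m _ = does≡true⇔ (r n ℚ.<? r m)

reconstructible-change : ∀ {φ c} → FreshExtensionProperty φ c → ∀ a → Reconstructible (change φ a)
reconstructible-change fresh a = reconstructible-of-extension (extension-change fresh a)

mainTheorem12 : ((φ : Coloring) → IsConstantColoring φ →
    (a : FinEdgeSet) → Reconstructible (change φ a))
    × ((φ : Coloring) → IsRandomGraphColoring φ →
    (a : FinEdgeSet) → Reconstructible (change φ a))
    × ((r : ℕ → ℚ) → IsEnumerationOfℚ r →
    (a : FinEdgeSet) → Reconstructible (change (sierpinski r) a))
    × ((R : Rel ℕ 0ℓ) → IsLinearOrderNoEndpoints R →
    (φ : Coloring) → IsColoringOfOrder R φ →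
    (a : FinEdgeSet) → Reconstructible (change φ a))
mainTheorem12 =
  (λ φ (b , const) → reconstructible-change (constant-freshExtension {φ} const)) ,
  (λ φ random → reconstructible-change (randomGraph-freshExtension {φ} random)) ,
  (λ r (r-injective , r-surjective) → reconstructible-change
     (StrictTotalOrderUnboundedAbove.order-freshExtension
        (sierpinski-isStrictTotalOrder r (r-injective _ _)) (sierpinski-unboundedAbove r r-surjective)
        (sierpinski-isColoringOfOrder r))) ,
  (λ R (isSTO , unbounded , _) φ φ-of-R → reconstructible-change
     (StrictTotalOrderUnboundedAbove.order-freshExtension isSTO unbounded φ-of-R))
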